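{- Let $k_1,k_2$ be integers with $0\le k_1<k_2$ and let $M=[-k_1,\,k_2]^*$. If $M$ splits an abelian group $G$ of order $2|M|+1$, then $G$ is cyclic and $k_1=0$.
   Context: For integers $a\le b$, $[a,b]^*=\{a,\dots,b\}\setminus\{0\}$. A set of integers $M$ splits an additive finite abelian group $G$ with splitter set $S\subseteq G$ if every nonzero $g\in G$ has a unique representation $g=ms$ with $m\in M$, $s\in S$, while $0$ has no such representation; here $ms$ is the $m$-fold sum of $s$ for $m\ge0$ and $-((-m)s)$ for $m<0$. -}

module Defs where

open import Level using (0ℓ)
open import Data.Nat as ℕ using (ℕ; zero; suc)
open import Data.Integer as ℤ using (ℤ; +_; -[1+_]; -_)
open import Data.Fin using (Fin)
open import Data.Product using (Σ; ∃; _×_; _,_)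
open import Relation.Nullary using (¬_)
open import Relation.Binary.PropositionalEquality using (_≡_)
open import Algebra.Structures using (IsAbelianGroup)
open import Function.Bundles using (_↔_)

record FinAbGroup (n : ℕ) : Set₁ where
  field
    Carrier        : Set
    _+_            : Carrier → Carrier → Carrier
    0#             : Carrier
    neg            : Carrier → Carrier
    isAbelianGroup : IsAbelianGroup _≡_ _+_ 0# neg
    enum           : Carrier ↔ Fin n

  ℕmul : ℕ → Carrier → Carrier
  ℕmul zero    s = 0#
  ℕmul (suc m) s = s + ℕmul m s

  infix 8 _·_
  _·_ : ℤ → Carrier → Carrier
  (+ m)      · s = ℕmul m s
  -[1+ m ]   · s = neg (ℕmul (suc m) s)

  IsCyclic : Set
  IsCyclic = ∃ λ (g : Carrier) → ∀ x → ∃ λ (m : ℤ) → x ≡ m · g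

  SplitsWith : (ℤ → Set) → (Carrier → Set) → Set
  SplitsWith M S =
      (∀ g → ¬ g ≡ 0# →
         Σ ℤ λ m → Σ Carrier λ s → M m × S s × g ≡ m · s)
    × (∀ m m′ s s′ → M m → M m′ → S s → S s′ → m · s ≡ m′ · s′ →
         m ≡ m′ × s ≡ s′)
    × (∀ m s → M m → S s → ¬ m · s ≡ 0#)

  Splits : (ℤ → Set) → Set₁
  Splits M = Σ (Carrier → Set) λ S → SplitsWith M S

[_,_]* : ℤ → ℤ → ℤ → Set
[ a , b ]* m = (a ℤ.≤ m × m ℤ.≤ b) × ¬ m ≡ + 0

{-# OPTIONS --safe #-}
-- Let s be a splitter. The multiples (i − k₁)s for 0 ≤ i ≤ k₁ + k₂ are 0 or lie in Ms, hence are
-- distinct, so s has more than |G|/2 distinct multiples; since a proper cyclic subgroup and one of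
-- its cosets fit into G, s generates G.
-- Suppose k₁ > 0 and write (k₂ + 1)s = m u with u a splitter. Then u ≠ s, and counting shows that
-- G is the disjoint union of Ms ∪ {0} and Mu. So (k₂ + 1 + r)s = (a_r − k₁)u with 0 ≤ a_r ≤ k₁ + k₂
-- for every r < k₁ + k₂, and a_{r+1}u = s + a_r u. As u generates G too, (a_r) is an arithmetic
-- progression; staying in [0, k₁ + k₂] for k₁ + k₂ ≥ 3 terms forces its difference into {0, ±1},
-- and these cases give s = 0, u = s and s = −u, each contradicting the splitting.
module Submission where

open import Defs
open import Data.Nat using (ℕ; _<_; _+_; _*_)
open import Data.Integer using (+_; -_)
open import Data.Product using (_×_)
open import Relation.Binary.PropositionalEquality using (_≡_)

open import Data.Nat as ℕ using (zero; suc; _≤_; _∸_; z≤n; s≤s; s≤s⁻¹; _≤?_; _<?_)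
open import Data.Nat.Properties as ℕP using ()
open import Data.Integer as ℤ using (ℤ; -[1+_]; _⊖_)
open import Data.Integer.Properties as ℤP using ()
open import Data.Fin as Fin using (Fin; toℕ)
open import Data.Fin.Properties as FinP using ()
open import Data.Product using (∃; ∃-syntax; _,_; proj₁; proj₂)
open import Data.Sum using (_⊎_; inj₁; inj₂; [_,_]′)
open import Data.Empty using (⊥; ⊥-elim)
open import Relation.Nullary using (¬_; Dec; yes; no)
open import Relation.Binary.Definitions using (tri<; tri≈; tri>)
import Relation.Nullary.Decidable as Dec
open import Relation.Binary.PropositionalEquality
  using (refl; sym; trans; cong; cong₂; subst; module ≡-Reasoning)
open import Function.Bundles using (_↔_; Inverse)
open import Algebra.Bundles using (AbelianGroup)
import Algebra.Properties.AbelianGroup as AbelianGroupProperties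
import Algebra.Properties.CommutativeSemigroup as CommutativeSemigroupProperties
open import Algebra.Structures using (IsAbelianGroup)
open import Data.Nat.Induction using (<-rec)

punchIn : ℕ → ℕ → ℕ
punchIn k j with j <? k
... | yes _ = j
... | no _  = suc j

punchIn≢ : ∀ k j → ¬ punchIn k j ≡ k
punchIn≢ k j with j <? k
... | yes j<k = λ j≡k → ℕP.<-irrefl j≡k j<k
... | no j≮k  = λ 1+j≡k → j≮k (subst (j <_) 1+j≡k (ℕP.n<1+n j))

punchIn≤1+ : ∀ k j → punchIn k j ≤ suc j
punchIn≤1+ k j with j <? k
... | yes _ = ℕP.n≤1+n j
... | no _  = ℕP.≤-refl

punchIn-injective : ∀ k {i j} → punchIn k i ≡ punchIn k j → i ≡ j
punchIn-injective k {i} {j} with i <? k | j <? k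
... | yes _   | yes _   = λ i≡j → i≡j
... | no _    | no _    = ℕP.suc-injective
... | yes i<k | no j≮k  = λ i≡1+j → ⊥-elim (j≮k (ℕP.<-trans (ℕP.n<1+n j) (subst (_< k) i≡1+j i<k)))
... | no i≮k  | yes j<k = λ 1+i≡j → ⊥-elim (i≮k (ℕP.<-trans (ℕP.n<1+n i) (subst (_< k) (sym 1+i≡j) j<k)))

⊖-cancelʳ : ∀ k {i j} → i ⊖ k ≡ j ⊖ k → i ≡ j
⊖-cancelʳ k {i} {j} eq = ℤP.+-injective (∙-cancelʳ (- + k) (+ i) (+ j) (begin
  + i ℤ.+ - + k  ≡⟨ ℤP.m-n≡m⊖n i k ⟩
  i ⊖ k          ≡⟨ eq ⟩
  j ⊖ k          ≡⟨ ℤP.m-n≡m⊖n j k ⟨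
  + j ℤ.+ - + k  ∎))
  where open AbelianGroupProperties ℤP.+-0-abelianGroup using (∙-cancelʳ)
        open ≡-Reasoning

⊖-∈[-k₁,k₂]* : ∀ {k₁ k₂ i} → i ≤ k₁ + k₂ → ¬ i ≡ k₁ → [ - + k₁ , + k₂ ]* (i ⊖ k₁)
⊖-∈[-k₁,k₂]* {k₁} {k₂} {i} i≤k₁+k₂ i≢k₁ with k₁ ≤? i
... | yes k₁≤i rewrite ℤP.⊖-≥ k₁≤i =
  (ℤP.neg-≤-pos , ℤ.+≤+ (ℕP.m≤n+o⇒m∸n≤o i k₁ i≤k₁+k₂)) ,
  λ i∸k₁≡0 → i≢k₁ (ℕP.≤-antisym (ℕP.m∸n≡0⇒m≤n (ℤP.+-injective i∸k₁≡0)) k₁≤i)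
... | no k₁≰i rewrite ℤP.⊖-≰ k₁≰i =
  (ℤP.neg-mono-≤ (ℤ.+≤+ (ℕP.m∸n≤m k₁ i)) , ℤP.neg-≤-pos) ,
  λ k₁∸i≡0 → k₁≰i (ℕP.m∸n≡0⇒m≤n (ℤP.+-injective (ℤP.neg-injective k₁∸i≡0)))

∈[-k₁,k₂]*⇒⊖ : ∀ {k₁ k₂ m} → [ - + k₁ , + k₂ ]* m →
               ∃[ i ] i ≤ k₁ + k₂ × ¬ i ≡ k₁ × m ≡ i ⊖ k₁
∈[-k₁,k₂]*⇒⊖ {k₁} {k₂} {+ p} ((_ , p≤k₂) , p≢0) =
  k₁ + p ,
  ℕP.+-monoʳ-≤ k₁ (ℤP.drop‿+≤+ p≤k₂) ,
  (λ k₁+p≡k₁ → p≢0 (cong +_ (ℕP.+-cancelˡ-≡ k₁ p 0 (trans k₁+p≡k₁ (sym (ℕP.+-identityʳ k₁)))))) ,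
  sym (trans (ℤP.⊖-≥ (ℕP.m≤m+n k₁ p)) (cong +_ (ℕP.m+n∸m≡n k₁ p)))
∈[-k₁,k₂]*⇒⊖ {k₁} {k₂} { -[1+ p ]} ((-k₁≤m , _) , _) =
  k₁ ∸ suc p ,
  ℕP.≤-trans (ℕP.m∸n≤m k₁ (suc p)) (ℕP.m≤m+n k₁ k₂) ,
  (λ eq → ℕP.<-irrefl eq k₁∸1+p<k₁) ,
  sym (trans (ℤP.⊖-< k₁∸1+p<k₁) (cong (λ j → - + j) (ℕP.m∸[m∸n]≡n 1+p≤k₁)))
  where
    1+p≤k₁ : suc p ≤ k₁
    1+p≤k₁ = ℤP.drop‿+≤+ (ℤP.neg-cancel-≤ -k₁≤m)
    k₁∸1+p<k₁ : k₁ ∸ suc p < k₁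
    k₁∸1+p<k₁ = ℕP.∸-monoʳ-< (s≤s z≤n) 1+p≤k₁

+-gap : ∀ {x y z w d} → x + y ≡ z + w → d + y ≤ z → d + w ≤ x
+-gap {x} {y} {z} {w} {d} x+y≡z+w d+y≤z = ℕP.+-cancelʳ-≤ y (d + w) x (begin
  d + w + y    ≡⟨ ℕP.+-assoc d w y ⟩
  d + (w + y)  ≡⟨ cong (_+_ d) (ℕP.+-comm w y) ⟩
  d + (y + w)  ≡⟨ ℕP.+-assoc d y w ⟨
  d + y + w    ≤⟨ ℕP.+-monoˡ-≤ w d+y≤z ⟩
  z + w        ≡⟨ x+y≡z+w ⟨
  x + y        ∎)
  where open ℕP.≤-Reasoning

r+r≤K⇒K≤2 : ∀ {K} → (∀ {r} → r < K → r + r ≤ K) → K ≤ 2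
r+r≤K⇒K≤2 {zero}                _     = z≤n
r+r≤K⇒K≤2 {suc zero}            _     = s≤s z≤n
r+r≤K⇒K≤2 {suc (suc zero)}      _     = s≤s (s≤s z≤n)
r+r≤K⇒K≤2 {suc (suc (suc m))} r+r≤K =
  ⊥-elim (ℕP.<⇒≱ (ℕP.m≤n+m (suc (suc m)) m) (s≤s⁻¹ (s≤s⁻¹ (r+r≤K ℕP.≤-refl))))

-- R r a encodes a_r = a; the sequence (a_r) is only known to exist for r < K.
module ArithmeticProgression {K a₀ a₁ : ℕ} (R : ℕ → ℕ → Set)
  (R-bounded : ∀ {r a} → R r a → a ≤ K)
  (R-total : ∀ {r} → r < K → ∃ (R r))
  (R-step : ∀ {r a a′} → R r a′ → R (suc r) a → a + a₀ ≡ a₁ + a′)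
  (R₀ : R 0 a₀) (R₁ : R 1 a₁)
  where

  open ℕP.≤-Reasoning

  R₀-unique : ∀ {a} → R 0 a → a ≡ a₀
  R₀-unique R₀a = sym (ℕP.+-cancelˡ-≡ a₁ a₀ _ (R-step R₀a R₁))

  ascending : 2 + a₀ ≤ a₁ → ∀ {r a} → r < K → R r a → r + r ≤ a
  ascending gap {zero}  _      _   = z≤n
  ascending gap {suc r} {a} 1+r<K Rra with R-total (ℕP.<⇒≤ 1+r<K)
  ... | a′ , Rra′ = begin
    suc r + suc r  ≡⟨ cong suc (ℕP.+-suc r r) ⟩
    2 + (r + r)    ≤⟨ ℕP.+-monoʳ-≤ 2 (ascending gap (ℕP.<⇒≤ 1+r<K) Rra′) ⟩
    2 + a′         ≤⟨ +-gap {d = 2} (R-step Rra′ Rra) gap ⟩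
    a              ∎

  descending : 2 + a₁ ≤ a₀ → ∀ {r a} → r < K → R r a → a + (r + r) ≤ a₀
  descending gap {zero}  {a} _ Rra = ℕP.≤-reflexive (trans (ℕP.+-identityʳ a) (R₀-unique Rra))
  descending gap {suc r} {a} 1+r<K Rra with R-total (ℕP.<⇒≤ 1+r<K)
  ... | a′ , Rra′ = begin
    a + (suc r + suc r)    ≡⟨ cong (_+_ a) (cong suc (ℕP.+-suc r r)) ⟩
    a + (2 + (r + r))      ≡⟨ ℕP.+-suc a (suc (r + r)) ⟩
    suc (a + suc (r + r))  ≡⟨ cong suc (ℕP.+-suc a (r + r)) ⟩
    2 + a + (r + r)        ≤⟨ ℕP.+-monoˡ-≤ (r + r) (+-gap {d = 2} a′+a₁≡a₀+a gap) ⟩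
    a′ + (r + r)           ≤⟨ descending gap (ℕP.<⇒≤ 1+r<K) Rra′ ⟩
    a₀                     ∎
    where
      a′+a₁≡a₀+a : a′ + a₁ ≡ a₀ + a
      a′+a₁≡a₀+a = trans (ℕP.+-comm a′ a₁) (trans (sym (R-step Rra′ Rra)) (ℕP.+-comm a a₀))

  difference∈±1 : 3 ≤ K → a₁ ≡ a₀ ⊎ a₁ ≡ suc a₀ ⊎ a₀ ≡ suc a₁
  difference∈±1 3≤K with ℕP.<-cmp a₀ a₁
  ... | tri≈ _ a₀≡a₁ _ = inj₁ (sym a₀≡a₁)
  ... | tri< a₀<a₁ _ _ with a₁ ℕ.≟ suc a₀
  ...   | yes a₁≡1+a₀ = inj₂ (inj₁ a₁≡1+a₀)
  ...   | no  a₁≢1+a₀ = ⊥-elim (ℕP.<⇒≱ 3≤K (r+r≤K⇒K≤2 λ r<K →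
          let a , Rra = R-total r<K
          in ℕP.≤-trans (ascending 2+a₀≤a₁ r<K Rra) (R-bounded Rra)))
    where
      2+a₀≤a₁ : 2 + a₀ ≤ a₁
      2+a₀≤a₁ = ℕP.≤∧≢⇒< a₀<a₁ (λ eq → a₁≢1+a₀ (sym eq))
  difference∈±1 3≤K | tri> _ _ a₁<a₀ with a₀ ℕ.≟ suc a₁
  ...   | yes a₀≡1+a₁ = inj₂ (inj₂ a₀≡1+a₁)
  ...   | no  a₀≢1+a₁ = ⊥-elim (ℕP.<⇒≱ 3≤K (r+r≤K⇒K≤2 λ {r} r<K →
          let a , Rra = R-total r<K
          in ℕP.≤-trans (ℕP.m≤n+m (r + r) a) (ℕP.≤-trans (descending 2+a₁≤a₀ r<K Rra) (R-bounded R₀))))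
    where
      2+a₁≤a₀ : 2 + a₁ ≤ a₀
      2+a₁≤a₀ = ℕP.≤∧≢⇒< a₁<a₀ (λ eq → a₀≢1+a₁ (sym eq))

module Counting {A : Set} {n : ℕ} (enum : A ↔ Fin n) where

  open Inverse enum using (to; from; strictlyInverseˡ; strictlyInverseʳ)

  to-injective : ∀ {x y} → to x ≡ to y → x ≡ y
  to-injective {x} {y} eq = trans (sym (strictlyInverseʳ x)) (trans (cong from eq) (strictlyInverseʳ y))

  from-injective : ∀ {k l} → from k ≡ from l → k ≡ l
  from-injective {k} {l} eq = trans (sym (strictlyInverseˡ k)) (trans (cong to eq) (strictlyInverseˡ l))

  infix 4 _≟_
  _≟_ : (x y : A) → Dec (x ≡ y)
  x ≟ y = Dec.map′ to-injective (cong to) (to x Fin.≟ to y)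

  InjectiveOn : (ℕ → A) → ℕ → Set
  InjectiveOn f a = ∀ {i j} → i < a → j < a → f i ≡ f j → i ≡ j

  Image : (ℕ → A) → ℕ → A → Set
  Image f a y = ∃[ i ] i < a × f i ≡ y

  image? : ∀ f a y → Dec (Image f a y)
  image? f zero    y = no λ ()
  image? f (suc a) y with f a ≟ y | image? f a y
  ... | yes fa≡y | _                  = yes (a , ℕP.n<1+n a , fa≡y)
  ... | no  _    | yes (i , i<a , eq) = yes (i , ℕP.m<n⇒m<1+n i<a , eq)
  ... | no  fa≢y | no  y∉fa           = no λ { (i , i<1+a , eq) → y∉image i<1+a eq }
    where
      y∉image : ∀ {i} → i < suc a → f i ≡ y → ⊥
      y∉image {i} i<1+a eq with i ℕ.≟ a
      ... | yes refl = fa≢y eq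
      ... | no  i≢a  = y∉fa (i , ℕP.≤∧≢⇒< (s≤s⁻¹ i<1+a) i≢a , eq)

  injectiveOn⇒≤ : ∀ {f a} → InjectiveOn f a → a ≤ n
  injectiveOn⇒≤ {f} inj = FinP.injective⇒≤ {f = λ i → to (f (toℕ i))}
    λ eq → FinP.toℕ-injective (inj (FinP.toℕ<n _) (FinP.toℕ<n _) (to-injective eq))

  ∃∉image : ∀ {f a} → a < n → ∃[ y ] ¬ Image f a y
  ∃∉image {f} {a} a<n with FinP.all? (λ k → image? f a (from k))
  ... | yes all = ⊥-elim (ℕP.<⇒≱ a<n (FinP.injective⇒≤ preimage-injective))
    where
      index : Fin n → ℕ
      index k = proj₁ (all k)

      preimage : Fin n → Fin a
      preimage k = Fin.fromℕ< (proj₁ (proj₂ (all k)))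

      preimage-injective : ∀ {k l} → preimage k ≡ preimage l → k ≡ l
      preimage-injective {k} {l} eq = from-injective (begin
        from k       ≡⟨ proj₂ (proj₂ (all k)) ⟨
        f (index k)  ≡⟨ cong f (FinP.fromℕ<-injective (index k) (index l) _ _ eq) ⟩
        f (index l)  ≡⟨ proj₂ (proj₂ (all l)) ⟩
        from l       ∎)
        where open ≡-Reasoning
  ... | no ¬all with FinP.¬∀⟶∃¬ n _ (λ k → image? f a (from k)) ¬all
  ...   | k , from-k∉ = from k , from-k∉

  join : (ℕ → A) → ℕ → (ℕ → A) → ℕ → A
  join f a g i with i <? a
  ... | yes _ = f i
  ... | no  _ = g (i ∸ a)

  private
    ∸-< : ∀ {a b i} → ¬ i < a → i < a + b → i ∸ a < b
    ∸-< {a} {b} {i} i≮a i<a+b =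
      ℕP.+-cancelˡ-< a _ _ (subst (_< a + b) (sym (ℕP.m+[n∸m]≡n (ℕP.≮⇒≥ i≮a))) i<a+b)

  join-injective : ∀ {f a g b} → InjectiveOn f a → InjectiveOn g b →
                   (∀ {i j} → i < a → j < b → ¬ f i ≡ g j) →
                   InjectiveOn (join f a g) (a + b)
  join-injective {f} {a} {g} {b} f-inj g-inj disjoint {i} {j} i<a+b j<a+b
    with i <? a | j <? a
  ... | yes i<a | yes j<a = f-inj i<a j<a
  ... | yes i<a | no  j≮a = λ eq → ⊥-elim (disjoint i<a (∸-< j≮a j<a+b) eq)
  ... | no  i≮a | yes j<a = λ eq → ⊥-elim (disjoint j<a (∸-< i≮a i<a+b) (sym eq))
  ... | no  i≮a | no  j≮a = λ eq →
    ℕP.∸-cancelʳ-≡ (ℕP.≮⇒≥ i≮a) (ℕP.≮⇒≥ j≮a) (g-inj (∸-< i≮a i<a+b) (∸-< j≮a j<a+b) eq)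

  join-image : ∀ {f a g b y} → Image (join f a g) (a + b) y → Image f a y ⊎ Image g b y
  join-image {f} {a} {g} {b} {y} (i , i<a+b , eq) with i <? a
  ... | yes i<a = inj₁ (i , i<a , eq)
  ... | no  i≮a = inj₂ (i ∸ a , ∸-< i≮a i<a+b , eq)

  injectiveOn⇒surjective : ∀ {f} → InjectiveOn f n → ∀ y → Image f n y
  injectiveOn⇒surjective {f} f-inj y with image? f n y
  ... | yes y∈f = y∈f
  ... | no  y∉f = ⊥-elim (ℕP.1+n≰n (subst (_≤ n) (ℕP.+-comm n 1)
          (injectiveOn⇒≤ (join-injective f-inj const-injective disjoint))))
    where
      const-injective : InjectiveOn (λ _ → y) 1
      const-injective (s≤s z≤n) (s≤s z≤n) _ = refl
      disjoint : ∀ {i j} → i < n → j < 1 → ¬ f i ≡ y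
      disjoint i<n _ eq = y∉f (_ , i<n , eq)

  disjoint-cover : ∀ {f a g b} → a + b ≡ n → InjectiveOn f a → InjectiveOn g b →
                   (∀ {i j} → i < a → j < b → ¬ f i ≡ g j) →
                   ∀ y → Image f a y ⊎ Image g b y
  disjoint-cover refl f-inj g-inj disjoint y =
    join-image (injectiveOn⇒surjective (join-injective f-inj g-inj disjoint) y)

module FinAbGroupProperties {n : ℕ} (G : FinAbGroup n) where

  open FinAbGroup G renaming (_+_ to infixl 6 _⊕_)
  open IsAbelianGroup isAbelianGroup using (assoc; identityˡ; identityʳ)
  open Counting enum public

  abelianGroup : AbelianGroup _ _
  abelianGroup = record { isAbelianGroup = isAbelianGroup }

  open AbelianGroupProperties abelianGroup public
    using (∙-cancelˡ; ∙-cancelʳ; inverseˡ-unique)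
  open AbelianGroupProperties abelianGroup using (ε⁻¹≈ε; ⁻¹-∙-comm; xyx⁻¹≈y)
  open CommutativeSemigroupProperties (AbelianGroup.commutativeSemigroup abelianGroup)
    using (xy∙z≈xz∙y)
  open ≡-Reasoning

  ℕmul-+ : ∀ a b x → ℕmul (a + b) x ≡ ℕmul a x ⊕ ℕmul b x
  ℕmul-+ zero    b x = sym (identityˡ _)
  ℕmul-+ (suc a) b x = trans (cong (x ⊕_) (ℕmul-+ a b x)) (sym (assoc _ _ _))

  ⊖-· : ∀ i k x → (i ⊖ k) · x ≡ ℕmul i x ⊕ neg (ℕmul k x)
  ⊖-· i       zero    x = sym (trans (cong (ℕmul i x ⊕_) ε⁻¹≈ε) (identityʳ _))
  ⊖-· zero    (suc k) x = sym (identityˡ _)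
  ⊖-· (suc i) (suc k) x = begin
    (suc i ⊖ suc k) · x                      ≡⟨ cong (_· x) (ℤP.[1+m]⊖[1+n]≡m⊖n i k) ⟩
    (i ⊖ k) · x                              ≡⟨ ⊖-· i k x ⟩
    ℕmul i x ⊕ neg (ℕmul k x)                ≡⟨ cong (_⊕ neg (ℕmul k x)) (xyx⁻¹≈y x (ℕmul i x)) ⟨
    x ⊕ ℕmul i x ⊕ neg x ⊕ neg (ℕmul k x)    ≡⟨ assoc _ _ _ ⟩
    x ⊕ ℕmul i x ⊕ (neg x ⊕ neg (ℕmul k x))  ≡⟨ cong (x ⊕ ℕmul i x ⊕_) (⁻¹-∙-comm x (ℕmul k x)) ⟩
    ℕmul (suc i) x ⊕ neg (ℕmul (suc k) x)    ∎

  ⊖-·-self : ∀ k x → (k ⊖ k) · x ≡ 0#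
  ⊖-·-self k x = cong (_· x) (ℤP.n⊖n≡0 k)

  ⊖-·-suc : ∀ i k x → (suc i ⊖ k) · x ≡ x ⊕ (i ⊖ k) · x
  ⊖-·-suc i k x = begin
    (suc i ⊖ k) · x                ≡⟨ ⊖-· (suc i) k x ⟩
    x ⊕ ℕmul i x ⊕ neg (ℕmul k x)  ≡⟨ assoc _ _ _ ⟩
    x ⊕ (ℕmul i x ⊕ neg (ℕmul k x)) ≡⟨ cong (x ⊕_) (⊖-· i k x) ⟨
    x ⊕ (i ⊖ k) · x                ∎

  ⊖-·-injectiveOn : ∀ {x a} k → InjectiveOn (λ i → ℕmul i x) a → InjectiveOn (λ i → (i ⊖ k) · x) a
  ⊖-·-injectiveOn {x} k inj {i} {j} i<a j<a eq =
    inj i<a j<a (∙-cancelʳ (neg (ℕmul k x)) _ _ (trans (sym (⊖-· i k x)) (trans eq (⊖-· j k x))))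

  ℕmul≡⇒ℕmul∸≡0 : ∀ {i j x} → i ≤ j → ℕmul i x ≡ ℕmul j x → ℕmul (j ∸ i) x ≡ 0#
  ℕmul≡⇒ℕmul∸≡0 {i} {j} {x} i≤j eq = ∙-cancelˡ (ℕmul i x) _ _ (begin
    ℕmul i x ⊕ ℕmul (j ∸ i) x  ≡⟨ ℕmul-+ i (j ∸ i) x ⟨
    ℕmul (i + (j ∸ i)) x       ≡⟨ cong (λ m → ℕmul m x) (ℕP.m+[n∸m]≡n i≤j) ⟩
    ℕmul j x                   ≡⟨ eq ⟨
    ℕmul i x                   ≡⟨ identityʳ _ ⟨
    ℕmul i x ⊕ 0#              ∎)

  ℕmul-injectiveOn : ∀ {x a} → (∀ {e} → 0 < e → e < a → ¬ ℕmul e x ≡ 0#) →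
                     InjectiveOn (λ i → ℕmul i x) a
  ℕmul-injectiveOn {x} {a} no-annihilator {i} {j} i<a j<a eq =
    [ (λ i≤j → ordered i≤j j<a eq) , (λ j≤i → sym (ordered j≤i i<a (sym eq))) ]′ (ℕP.≤-total i j)
    where
      ordered : ∀ {i j} → i ≤ j → j < a → ℕmul i x ≡ ℕmul j x → i ≡ j
      ordered {i} {j} i≤j j<a eq with ℕP.m≤n⇒m<n∨m≡n i≤j
      ... | inj₂ i≡j = i≡j
      ... | inj₁ i<j = ⊥-elim (no-annihilator (ℕP.m<n⇒0<n∸m i<j)
                         (ℕP.≤-<-trans (ℕP.m∸n≤m j i) j<a) (ℕmul≡⇒ℕmul∸≡0 i≤j eq))

  ℕmul-reduce : ∀ {x d} → ℕmul d x ≡ 0# → 0 < d → ∀ m → ∃[ r ] r < d × ℕmul m x ≡ ℕmul r x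
  ℕmul-reduce dx≡0 0<d zero = 0 , 0<d , refl
  ℕmul-reduce {x} {d} dx≡0 0<d (suc m) with ℕmul-reduce dx≡0 0<d m
  ... | r , r<d , mx≡rx with suc r ℕ.≟ d
  ...   | yes 1+r≡d = 0 , 0<d , trans (cong (x ⊕_) mx≡rx) (trans (cong (λ k → ℕmul k x) 1+r≡d) dx≡0)
  ...   | no  1+r≢d = suc r , ℕP.≤∧≢⇒< r<d 1+r≢d , cong (x ⊕_) mx≡rx

  -- A proper cyclic subgroup and a coset of it give 2d distinct elements.
  proper-cyclic-subgroup-≤-half : ∀ {x d} → InjectiveOn (λ i → ℕmul i x) d → ℕmul d x ≡ 0# →
                                  d < n → d + d ≤ n
  proper-cyclic-subgroup-≤-half {d = zero} _ _ _ = z≤n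
  proper-cyclic-subgroup-≤-half {x} {d@(suc _)} inj dx≡0 d<n with ∃∉image {f = λ i → ℕmul i x} d<n
  ... | y , y∉⟨x⟩ = injectiveOn⇒≤ (join-injective inj coset-injective disjoint)
    where
      coset-injective : InjectiveOn (λ j → y ⊕ ℕmul j x) d
      coset-injective i<d j<d eq = inj i<d j<d (∙-cancelˡ y _ _ eq)

      disjoint : ∀ {i j} → i < d → j < d → ¬ ℕmul i x ≡ y ⊕ ℕmul j x
      disjoint {i} {j} i<d j<d ix≡y+jx with ℕmul-reduce dx≡0 (s≤s z≤n) (i + (d ∸ j))
      ... | r , r<d , eq = y∉⟨x⟩ (r , r<d , trans (sym eq) (begin
        ℕmul (i + (d ∸ j)) x           ≡⟨ ℕmul-+ i (d ∸ j) x ⟩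
        ℕmul i x ⊕ ℕmul (d ∸ j) x      ≡⟨ cong (_⊕ ℕmul (d ∸ j) x) ix≡y+jx ⟩
        y ⊕ ℕmul j x ⊕ ℕmul (d ∸ j) x  ≡⟨ assoc _ _ _ ⟩
        y ⊕ (ℕmul j x ⊕ ℕmul (d ∸ j) x) ≡⟨ cong (y ⊕_) (ℕmul-+ j (d ∸ j) x) ⟨
        y ⊕ ℕmul (j + (d ∸ j)) x       ≡⟨ cong (λ m → y ⊕ ℕmul m x) (ℕP.m+[n∸m]≡n (ℕP.<⇒≤ j<d)) ⟩
        y ⊕ ℕmul d x                   ≡⟨ cong (y ⊕_) dx≡0 ⟩
        y ⊕ 0#                         ≡⟨ identityʳ y ⟩
        y                              ∎))

  ℕmul-injectiveOn-beyond-half : ∀ {x a} → n < a + a →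
                                 InjectiveOn (λ i → ℕmul i x) a → InjectiveOn (λ i → ℕmul i x) n
  ℕmul-injectiveOn-beyond-half {x} {a} n<a+a inj =
    ℕmul-injectiveOn (λ {e} → <-rec NoAnnihilator no-annihilator e)
    where
      NoAnnihilator : ℕ → Set
      NoAnnihilator e = 0 < e → e < n → ¬ ℕmul e x ≡ 0#

      no-annihilator : ∀ e → (∀ {e′} → e′ < e → NoAnnihilator e′) → NoAnnihilator e
      no-annihilator e IH 0<e e<n ex≡0 with e <? a
      ... | yes e<a = ℕP.<-irrefl (sym (inj e<a (ℕP.<-trans 0<e e<a) ex≡0)) 0<e
      ... | no  e≮a = ℕP.<-irrefl refl (ℕP.<-≤-trans n<a+a (ℕP.≤-trans
                         (ℕP.+-mono-≤ (ℕP.≮⇒≥ e≮a) (ℕP.≮⇒≥ e≮a))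
                         (proper-cyclic-subgroup-≤-half ⟨x⟩-injective ex≡0 e<n)))
        where
          ⟨x⟩-injective : InjectiveOn (λ i → ℕmul i x) e
          ⟨x⟩-injective = ℕmul-injectiveOn λ 0<e′ e′<e → IH e′<e 0<e′ (ℕP.<-trans e′<e e<n)

  ℕmul-injectiveOn⇒IsCyclic : ∀ {x} → InjectiveOn (λ i → ℕmul i x) n → IsCyclic
  ℕmul-injectiveOn⇒IsCyclic {x} inj = x , λ y →
    let i , _ , ix≡y = injectiveOn⇒surjective inj y in + i , sym ix≡y

  ℕmul-difference-injective : ∀ {u s m a a′ a₀ a₁} → InjectiveOn (λ i → ℕmul i u) m →
                              a + a₀ < m → a₁ + a′ < m →
                              ℕmul a u ≡ s ⊕ ℕmul a′ u → ℕmul a₁ u ≡ s ⊕ ℕmul a₀ u →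
                              a + a₀ ≡ a₁ + a′
  ℕmul-difference-injective {u} {s} {a = a} {a′} {a₀} {a₁} inj a+a₀<m a₁+a′<m step step₀ =
    inj a+a₀<m a₁+a′<m (begin
    ℕmul (a + a₀) u            ≡⟨ ℕmul-+ a a₀ u ⟩
    ℕmul a u ⊕ ℕmul a₀ u       ≡⟨ cong (_⊕ ℕmul a₀ u) step ⟩
    s ⊕ ℕmul a′ u ⊕ ℕmul a₀ u  ≡⟨ xy∙z≈xz∙y s (ℕmul a′ u) (ℕmul a₀ u) ⟩
    s ⊕ ℕmul a₀ u ⊕ ℕmul a′ u  ≡⟨ cong (_⊕ ℕmul a′ u) step₀ ⟨
    ℕmul a₁ u ⊕ ℕmul a′ u      ≡⟨ ℕmul-+ a₁ a′ u ⟨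
    ℕmul (a₁ + a′) u           ∎)

module Splitting {k₁ k₂ : ℕ} (k₁<k₂ : k₁ < k₂) (G : FinAbGroup (2 * (k₁ + k₂) + 1))
  (S : FinAbGroup.Carrier G → Set) (split : FinAbGroup.SplitsWith G [ - + k₁ , + k₂ ]* S)
  where

  open FinAbGroup G renaming (_+_ to infixl 6 _⊕_)
  open FinAbGroupProperties G
  open IsAbelianGroup isAbelianGroup using (assoc; identityˡ; identityʳ)

  K : ℕ
  K = k₁ + k₂

  M : ℤ → Set
  M = [ - + k₁ , + k₂ ]*

  cover : ∀ g → ¬ g ≡ 0# → ∃[ m ] ∃[ s ] M m × S s × g ≡ m · s
  cover = proj₁ split

  unique : ∀ {m m′ s s′} → M m → M m′ → S s → S s′ → m · s ≡ m′ · s′ → m ≡ m′ × s ≡ s′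
  unique = proj₁ (proj₂ split) _ _ _ _

  nonzero : ∀ {m s} → M m → S s → ¬ m · s ≡ 0#
  nonzero = proj₂ (proj₂ split) _ _

  0<K : 0 < K
  0<K = ℕP.≤-trans (s≤s z≤n) (ℕP.≤-trans k₁<k₂ (ℕP.m≤n+m k₂ k₁))

  ∣G∣≡1+K+K : 2 * K + 1 ≡ suc (K + K)
  ∣G∣≡1+K+K = trans (ℕP.+-comm (2 * K) 1) (cong (λ m → suc (K + m)) (ℕP.+-identityʳ K))

  ≤K+K⇒<∣G∣ : ∀ {i} → i ≤ K + K → i < 2 * K + 1
  ≤K+K⇒<∣G∣ {i} i≤K+K = subst (i <_) (sym ∣G∣≡1+K+K) (s≤s i≤K+K)

  ≤K⇒<∣G∣ : ∀ {i} → i ≤ K → i < 2 * K + 1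
  ≤K⇒<∣G∣ {i} i≤K = ≤K+K⇒<∣G∣ (ℕP.≤-trans i≤K (ℕP.m≤m+n K K))

  splitter-⊖-injective : ∀ {x i j} → S x → i ≤ K → j ≤ K → (i ⊖ k₁) · x ≡ (j ⊖ k₁) · x → i ≡ j
  splitter-⊖-injective {x} {i} {j} Sx i≤K j≤K eq with i ℕ.≟ k₁ | j ℕ.≟ k₁
  ... | yes i≡k₁ | yes j≡k₁ = trans i≡k₁ (sym j≡k₁)
  ... | yes i≡k₁ | no  j≢k₁ = ⊥-elim (nonzero (⊖-∈[-k₁,k₂]* j≤K j≢k₁) Sx
    (trans (sym eq) (trans (cong (λ i → (i ⊖ k₁) · x) i≡k₁) (⊖-·-self k₁ x))))
  ... | no  i≢k₁ | yes j≡k₁ = ⊥-elim (nonzero (⊖-∈[-k₁,k₂]* i≤K i≢k₁) Sx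
    (trans eq (trans (cong (λ j → (j ⊖ k₁) · x) j≡k₁) (⊖-·-self k₁ x))))
  ... | no  i≢k₁ | no  j≢k₁ =
    ⊖-cancelʳ k₁ (proj₁ (unique (⊖-∈[-k₁,k₂]* i≤K i≢k₁) (⊖-∈[-k₁,k₂]* j≤K j≢k₁) Sx Sx eq))

  splitter-generates : ∀ {x} → S x → InjectiveOn (λ i → ℕmul i x) (2 * K + 1)
  splitter-generates {x} Sx = ℕmul-injectiveOn-beyond-half ∣G∣<2[K+1] λ {i} {j} i<1+K j<1+K ix≡jx →
    splitter-⊖-injective Sx (s≤s⁻¹ i<1+K) (s≤s⁻¹ j<1+K)
      (trans (⊖-· i k₁ x) (trans (cong (_⊕ neg (ℕmul k₁ x)) ix≡jx) (sym (⊖-· j k₁ x))))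
    where
      ∣G∣<2[K+1] : 2 * K + 1 < suc K + suc K
      ∣G∣<2[K+1] = subst (_< suc K + suc K) (sym ∣G∣≡1+K+K) (s≤s (ℕP.+-monoʳ-< K (ℕP.n<1+n K)))

  splitter : ∃ S
  splitter with ∃∉image {f = λ _ → 0#} (≤K+K⇒<∣G∣ (ℕP.≤-trans 0<K (ℕP.m≤m+n K K)))
  ... | g , g≢0 with cover g (λ g≡0 → g≢0 (0 , s≤s z≤n , sym g≡0))
  ...   | _ , s , _ , Ss , _ = s , Ss

  s : Carrier
  s = proj₁ splitter

  Ss : S s
  Ss = proj₂ splitter

  isCyclic : IsCyclic
  isCyclic = ℕmul-injectiveOn⇒IsCyclic (splitter-generates Ss)

  σ : ℕ → Carrier
  σ i = (i ⊖ k₁) · s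

  σ-injective : InjectiveOn σ (2 * K + 1)
  σ-injective = ⊖-·-injectiveOn k₁ (splitter-generates Ss)

  1+K+r<∣G∣ : ∀ {r} → r < K → suc K + r < 2 * K + 1
  1+K+r<∣G∣ {r} r<K = ≤K+K⇒<∣G∣ (subst (_≤ K + K) (ℕP.+-suc K r) (ℕP.+-monoʳ-≤ K r<K))

  σ[1+K+r]≢σ[≤K] : ∀ {i r} → i ≤ K → r < K → ¬ σ i ≡ σ (suc K + r)
  σ[1+K+r]≢σ[≤K] {i} {r} i≤K r<K σi≡σ[1+K+r] = ℕP.<⇒≢ (s≤s (ℕP.≤-trans i≤K (ℕP.m≤m+n K r)))
    (σ-injective (≤K⇒<∣G∣ i≤K) (1+K+r<∣G∣ r<K) σi≡σ[1+K+r])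

  σ[1+K]≢0 : ¬ σ (suc K) ≡ 0#
  σ[1+K]≢0 σ[1+K]≡0 = σ[1+K+r]≢σ[≤K] (ℕP.m≤m+n k₁ k₂) 0<K
    (trans (⊖-·-self k₁ s) (trans (sym σ[1+K]≡0) (cong σ (sym (ℕP.+-identityʳ (suc K))))))

  module SecondSplitter (0<k₁ : 0 < k₁) {m₀ u} (Mm₀ : M m₀) (Su : S u) (σ[1+K]≡m₀u : σ (suc K) ≡ m₀ · u)
    where

    u≢s : ¬ u ≡ s
    u≢s u≡s with ∈[-k₁,k₂]*⇒⊖ Mm₀
    ... | i , i≤K , _ , m₀≡i⊖k₁ = σ[1+K+r]≢σ[≤K] i≤K 0<K (begin
      σ i            ≡⟨ cong₂ _·_ m₀≡i⊖k₁ u≡s ⟨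
      m₀ · u         ≡⟨ σ[1+K]≡m₀u ⟨
      σ (suc K)      ≡⟨ cong σ (ℕP.+-identityʳ (suc K)) ⟨
      σ (suc K + 0)  ∎)
      where open ≡-Reasoning

    -- j ↦ punchIn k₁ j ⊖ k₁ enumerates M for j < K.
    τ : ℕ → Carrier
    τ j = (punchIn k₁ j ⊖ k₁) · u

    punchIn≤K : ∀ {j} → j < K → punchIn k₁ j ≤ K
    punchIn≤K {j} j<K = ℕP.≤-trans (punchIn≤1+ k₁ j) j<K

    τ-injective : InjectiveOn τ K
    τ-injective i<K j<K τi≡τj =
      punchIn-injective k₁ (splitter-⊖-injective Su (punchIn≤K i<K) (punchIn≤K j<K) τi≡τj)

    σ-τ-disjoint : ∀ {i j} → i < suc K → j < K → ¬ σ i ≡ τ j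
    σ-τ-disjoint {i} {j} i<1+K j<K σi≡τj with i ℕ.≟ k₁
    ... | yes i≡k₁ = nonzero (⊖-∈[-k₁,k₂]* (punchIn≤K j<K) (punchIn≢ k₁ j)) Su
                       (trans (sym σi≡τj) (trans (cong σ i≡k₁) (⊖-·-self k₁ s)))
    ... | no  i≢k₁ = u≢s (sym (proj₂ (unique (⊖-∈[-k₁,k₂]* (s≤s⁻¹ i<1+K) i≢k₁)
                                       (⊖-∈[-k₁,k₂]* (punchIn≤K j<K) (punchIn≢ k₁ j)) Ss Su σi≡τj)))

    σ-τ-cover : ∀ y → Image σ (suc K) y ⊎ Image τ K y
    σ-τ-cover = disjoint-cover (sym ∣G∣≡1+K+K)
      (λ i<1+K j<1+K → splitter-⊖-injective Ss (s≤s⁻¹ i<1+K) (s≤s⁻¹ j<1+K)) τ-injective σ-τ-disjoint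

    Position : ℕ → ℕ → Set
    Position r a = a ≤ K × (a ⊖ k₁) · u ≡ σ (suc K + r)

    position : ∀ {r} → r < K → ∃ (Position r)
    position {r} r<K with σ-τ-cover (σ (suc K + r))
    ... | inj₁ (i , i<1+K , σi≡) = ⊥-elim (σ[1+K+r]≢σ[≤K] (s≤s⁻¹ i<1+K) r<K σi≡)
    ... | inj₂ (j , j<K   , τj≡) = punchIn k₁ j , punchIn≤K j<K , τj≡

    position-step : ∀ {r a a′} → Position r a′ → Position (suc r) a → ℕmul a u ≡ s ⊕ ℕmul a′ u
    position-step {r} {a} {a′} (_ , P′) (_ , P) = ∙-cancelʳ (neg (ℕmul k₁ u)) _ _ (begin
      ℕmul a u ⊕ neg (ℕmul k₁ u)         ≡⟨ ⊖-· a k₁ u ⟨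
      (a ⊖ k₁) · u                       ≡⟨ P ⟩
      σ (suc K + suc r)                  ≡⟨ cong σ (ℕP.+-suc (suc K) r) ⟩
      σ (suc (suc K + r))                ≡⟨ ⊖-·-suc (suc K + r) k₁ s ⟩
      s ⊕ σ (suc K + r)                  ≡⟨ cong (s ⊕_) P′ ⟨
      s ⊕ (a′ ⊖ k₁) · u                  ≡⟨ cong (s ⊕_) (⊖-· a′ k₁ u) ⟩
      s ⊕ (ℕmul a′ u ⊕ neg (ℕmul k₁ u))  ≡⟨ assoc _ _ _ ⟨
      s ⊕ ℕmul a′ u ⊕ neg (ℕmul k₁ u)    ∎)
      where open ≡-Reasoning

    1∈M : M (+ 1)
    1∈M = (ℤP.neg-≤-pos , ℤ.+≤+ (ℕP.≤-trans (s≤s z≤n) k₁<k₂)) , λ ()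

    -1∈M : M -[1+ 0 ]
    -1∈M = (ℤP.neg-mono-≤ (ℤ.+≤+ 0<k₁) , ℤ.-≤+) , λ ()

    ¬constant : ∀ {a} → ¬ ℕmul a u ≡ s ⊕ ℕmul a u
    ¬constant eq = nonzero 1∈M Ss
      (trans (identityʳ s) (∙-cancelʳ _ s 0# (trans (sym eq) (sym (identityˡ _)))))

    ¬ascending : ∀ {a} → ¬ ℕmul (suc a) u ≡ s ⊕ ℕmul a u
    ¬ascending eq = u≢s (∙-cancelʳ _ u s eq)

    ¬descending : ∀ {a} → ¬ ℕmul a u ≡ s ⊕ ℕmul (suc a) u
    ¬descending eq = +1≢-1 (proj₁ (unique 1∈M -1∈M Ss Su
      (trans (identityʳ s) (trans s≡-u (cong neg (sym (identityʳ u)))))))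
      where
        +1≢-1 : ¬ + 1 ≡ -[1+ 0 ]
        +1≢-1 ()
        s≡-u : s ≡ neg u
        s≡-u = inverseˡ-unique s u
          (∙-cancelʳ _ _ _ (trans (assoc s u _) (trans (sym eq) (sym (identityˡ _)))))

    3≤K : 3 ≤ K
    3≤K = ℕP.+-mono-≤ 0<k₁ (ℕP.≤-trans (s≤s 0<k₁) k₁<k₂)

    module _ {a₀ a₁} (P₀ : Position 0 a₀) (P₁ : Position 1 a₁) where

      step₀ : ℕmul a₁ u ≡ s ⊕ ℕmul a₀ u
      step₀ = position-step P₀ P₁

      position-linear : ∀ {r a a′} → Position r a′ → Position (suc r) a → a + a₀ ≡ a₁ + a′
      position-linear {a = a} {a′} P′@(a′≤K , _) P@(a≤K , _) =
        ℕmul-difference-injective {a = a} {a′} {a₀} {a₁} (splitter-generates Su)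
        (≤K+K⇒<∣G∣ (ℕP.+-mono-≤ a≤K (proj₁ P₀))) (≤K+K⇒<∣G∣ (ℕP.+-mono-≤ (proj₁ P₁) a′≤K))
        (position-step P′ P) step₀

      open ArithmeticProgression Position proj₁ position position-linear P₀ P₁ using (difference∈±1)

      no-progression : ⊥
      no-progression with difference∈±1 3≤K
      ... | inj₁ a₁≡a₀ = ¬constant {a₀} (subst (λ a → ℕmul a u ≡ s ⊕ ℕmul a₀ u) a₁≡a₀ step₀)
      ... | inj₂ (inj₁ a₁≡1+a₀) = ¬ascending {a₀} (subst (λ a → ℕmul a u ≡ s ⊕ ℕmul a₀ u) a₁≡1+a₀ step₀)
      ... | inj₂ (inj₂ a₀≡1+a₁) = ¬descending {a₁} (subst (λ a → ℕmul a₁ u ≡ s ⊕ ℕmul a u) a₀≡1+a₁ step₀)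

    contradiction : ⊥
    contradiction =
      no-progression (proj₂ (position 0<K)) (proj₂ (position (ℕP.<-≤-trans (s≤s (s≤s z≤n)) 3≤K)))

  k₁≡0 : k₁ ≡ 0
  k₁≡0 = ℕP.n≤0⇒n≡0 (ℕP.≮⇒≥ λ 0<k₁ →
    let m₀ , u , Mm₀ , Su , σ[1+K]≡m₀u = cover (σ (suc K)) σ[1+K]≢0
    in SecondSplitter.contradiction 0<k₁ Mm₀ Su σ[1+K]≡m₀u)

lemma4p6 : (k₁ k₂ : ℕ) → k₁ < k₂ →
           (G : FinAbGroup (2 * (k₁ + k₂) + 1)) →
           FinAbGroup.Splits G [ - (+ k₁) , + k₂ ]* →
           FinAbGroup.IsCyclic G × k₁ ≡ 0
lemma4p6 k₁ k₂ k₁<k₂ G (S , split) = isCyclic , k₁≡0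
  where open Splitting k₁<k₂ G S split
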